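{- Let $m\ge3$ be an odd integer, $\mathbf{a}=[(-1)^i(1+2i):0\le i<m]$ and $\mathbf{b}=[(-1)^i(1+2i)m-m:0\le i<m]$. Then $\langle\mathbf{a},\mathbf{b}\rangle$ is admissible. Moreover, if any number of entries $b_i$ of $\mathbf{b}$ with $i\ne0$ are replaced by $b_i'=-b_i-2$, the resulting pair $\langle\mathbf{a},\mathbf{b}'\rangle$ is admissible. Similarly, if any number of entries $a_i$ of $\mathbf{a}$ with $i\neq 0$ are replaced by $a_i'=-a_i$, the resulting pair $\langle\mathbf{a}',\mathbf{b}\rangle$ is admissible.
   Context: $\mathcal{N}_N=\{1-N,3-N,\ldots,N-1\}$. For odd $m\ge3$, a pair $\langle[a_0,\ldots,a_{m-1}],[b_0,\ldots,b_{m-1}]\rangle$ of integer sequences is admissible if all $a_i$ are odd integers in $\{1-2m^2,\ldots,2m^2-1\}$, all $b_i$ are even integers in $\{ -2m^2,\ldots,2m^2-2\}$, $a_0=1$, $b_0=0$, and $\{x(a_i+b_j):x\in\{ -1,1\},0\le i,j<m\}=\mathcal{N}_{2m^2}$. -}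

module Defs where

open import Data.Nat as ℕ using (ℕ)
open import Data.Integer using (ℤ; +_; -_; _+_; _-_; _*_; _^_; _≤_)
open import Data.Bool using (Bool; if_then_else_)
open import Data.Product using (_×_; ∃; ∃-syntax)
open import Data.Sum using (_⊎_)
open import Function.Bundles using (_⇔_)
open import Relation.Binary.PropositionalEquality using (_≡_)

-- Integer sequences of length m are represented as functions ℕ → ℤ,
-- of which only the entries with index i < m are relevant.
Seq : Set
Seq = ℕ → ℤ

OddZ : ℤ → Set
OddZ z = ∃[ k ] z ≡ (+ 2) * k + + 1

EvenZ : ℤ → Set
EvenZ z = ∃[ k ] z ≡ (+ 2) * k

InN : ℕ → ℤ → Set
InN N z = ∃[ k ] (k ℕ.< N × z ≡ (+ 1 - + N) + (+ 2) * (+ k))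

InSums : ℕ → Seq → Seq → ℤ → Set
InSums m a b z = ∃[ i ] ∃[ j ] (i ℕ.< m × j ℕ.< m × (z ≡ a i + b j ⊎ z ≡ - (a i + b j)))

Admissible : ℕ → Seq → Seq → Set
Admissible m a b =
  (∀ i → i ℕ.< m → OddZ (a i) × (+ 1 - + (2 ℕ.* m ℕ.* m)) ≤ a i × a i ≤ + (2 ℕ.* m ℕ.* m) - + 1)
  × (∀ j → j ℕ.< m → EvenZ (b j) × - + (2 ℕ.* m ℕ.* m) ≤ b j × b j ≤ + (2 ℕ.* m ℕ.* m) - + 2)
  × a 0 ≡ + 1
  × b 0 ≡ + 0
  × (∀ z → InSums m a b z ⇔ InN (2 ℕ.* m ℕ.* m) z)

seqA : Seq
seqA i = (- + 1) ^ i * (+ 1 + + 2 * + i)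

seqB : ℕ → Seq
seqB m i = (- + 1) ^ i * (+ 1 + + 2 * + i) * + m - + m

replB : (ℕ → Bool) → Seq → Seq
replB s b i = if s i then - b i - + 2 else b i

replA : (ℕ → Bool) → Seq → Seq
replA s a i = if s i then - a i else a i

-- Write m = 2h + 1 and 𝒬ₙ = {3 - 2n + 4c : c < n}.  Up to order, a₀, …, a_{m-1} enumerate 𝒬ₘ
-- (a_{2p} = 1 + 4p and a_{2p+1} = -(3 + 4p)), and b_j = m (a_j - 1).  Expanding the index of an
-- element of 𝒬_{m²} in radix m gives 𝒬_{m²} = 𝒬ₘ + m (𝒬ₘ - 1), so the sums a_i + b_j enumerate 𝒬_{m²},
-- and 𝒩_{2m²} = 𝒬_{m²} ∪ -𝒬_{m²}.  As 𝒬ₘ is invariant under x ↦ 2 - x, an entry b′_j = -b_j - 2 gives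
-- a_i + b_j = -((2 - a_i) + b′_j), so the set of sums ±(a_i + b_j) does not change; the same holds for
-- a′_i = -a_i, because the b_j are closed under negation.

{-# OPTIONS --safe #-}
module Submission where

open import Defs
open import Data.Bool using (Bool; false; true)
open import Data.Nat as ℕ using (ℕ; suc; _≤_; _<_; _%_; _/_; NonZero; s≤s; z≤n)
import Data.Nat.Properties as ℕ
open import Data.Nat.DivMod using (m≡m%n+[m/n]*n; m%n<n; m<n*o⇒m/o<n)
open import Data.Integer using (ℤ; +_; -_; _+_; _-_; _*_; _^_; 0ℤ) renaming (_≤_ to _≤ℤ_)
import Data.Integer.Properties as ℤ
open import Data.Integer.Tactic.RingSolver using (solve-∀)
open import Data.Product using (_×_; ∃-syntax; _,_)
open import Data.Sum as ⊎ using (_⊎_; inj₁; inj₂)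
open import Data.Sum.Function.Propositional using (_⊎-⇔_)
open import Function.Base using (_∘_)
open import Function.Bundles using (_⇔_; mk⇔; Equivalence)
import Function.Properties.Equivalence as ⇔
open import Relation.Binary.PropositionalEquality
  using (_≡_; refl; sym; trans; cong; cong₂; subst; subst₂; module ≡-Reasoning)
open ≡-Reasoning

<*⇒digits : ∀ {c n} b .{{_ : NonZero b}} → c < n ℕ.* b →
            ∃[ d ] ∃[ q ] d < b × q < n × c ≡ d ℕ.+ q ℕ.* b
<*⇒digits {c} b c<nb = c % b , c / b , m%n<n c b , m<n*o⇒m/o<n c<nb , m≡m%n+[m/n]*n c b

digits⇒<* : ∀ {d q n b} → d < b → q < n → d ℕ.+ q ℕ.* b < n ℕ.* b
digits⇒<* {q = q} {b = b} d<b q<n =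
  ℕ.<-≤-trans (ℕ.+-monoˡ-< (q ℕ.* b) d<b) (ℕ.*-monoˡ-≤ b q<n)

2mm≡mm2 : ∀ m → 2 ℕ.* m ℕ.* m ≡ m ℕ.* m ℕ.* 2
2mm≡mm2 m = trans (ℕ.*-assoc 2 m m) (ℕ.*-comm 2 (m ℕ.* m))

n*2≡n+n : ∀ n → n ℕ.* 2 ≡ n ℕ.+ n
n*2≡n+n n = trans (ℕ.*-comm n 2) (cong (n ℕ.+_) (ℕ.+-identityʳ n))

+[1+n*2] : ∀ n → + suc (n ℕ.* 2) ≡ + 1 + + n * + 2
+[1+n*2] n = trans (ℤ.pos-+ 1 (n ℕ.* 2)) (cong (λ t → + 1 + t) (ℤ.pos-* n 2))

-1^[n*2]≡1 : ∀ n → (- + 1) ^ (n ℕ.* 2) ≡ + 1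
-1^[n*2]≡1 n = begin
  (- + 1) ^ (n ℕ.* 2)     ≡⟨ cong ((- + 1) ^_) (ℕ.*-comm n 2) ⟩
  (- + 1) ^ (2 ℕ.* n)     ≡⟨ ℤ.^-*-assoc (- + 1) 2 n ⟨
  ((- + 1) ^ 2) ^ n       ≡⟨ ℤ.^-zeroˡ n ⟩
  + 1                     ∎

+-cancelˡ-≤ : ∀ s {x y} → s + x ≤ℤ s + y → x ≤ℤ y
+-cancelˡ-≤ s {x} {y} s+x≤s+y = subst₂ _≤ℤ_ (cancel x) (cancel y) (ℤ.+-monoʳ-≤ (- s) s+x≤s+y)
  where
  cancel : ∀ t → - s + (s + t) ≡ t
  cancel t = begin
    - s + (s + t)   ≡⟨ ℤ.+-assoc (- s) s t ⟨
    (- s + s) + t   ≡⟨ cong (_+ t) (ℤ.+-inverseˡ s) ⟩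
    0ℤ + t          ≡⟨ ℤ.+-identityˡ t ⟩
    t               ∎

InN-odd : ∀ n {z} → InN (n ℕ.* 2) z → OddZ z
InN-odd n (k , _ , z≡) =
  + k - + n , trans z≡ (trans (cong (λ N → (+ 1 - N) + + 2 * + k) (ℤ.pos-* n 2)) (ring (+ n) (+ k)))
  where
  ring : ∀ N K → (+ 1 - N * + 2) + + 2 * K ≡ + 2 * (K - N) + + 1
  ring = solve-∀

OddZ-suc⇒EvenZ : ∀ {x} → OddZ (+ 1 + x) → EvenZ x
OddZ-suc⇒EvenZ {x} (k , 1+x≡) = k , (begin
  x                       ≡⟨ ring₁ x ⟩
  (+ 1 + x) - + 1         ≡⟨ cong (_- + 1) 1+x≡ ⟩
  (+ 2 * k + + 1) - + 1   ≡⟨ ring₂ k ⟩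
  + 2 * k                 ∎)
  where
  ring₁ : ∀ x → x ≡ (+ 1 + x) - + 1
  ring₁ = solve-∀
  ring₂ : ∀ k → (+ 2 * k + + 1) - + 1 ≡ + 2 * k
  ring₂ = solve-∀

InN-bounds : ∀ {z N} → InN N z → + 1 - + N ≤ℤ z × z ≤ℤ + N - + 1
InN-bounds {z} (k , k<N , z≡) with ℕ.m≤n⇒∃[o]m+o≡n k<N
... | d , refl =
  ≤-by (2 ℕ.* k) (trans z≡ (cong (λ t → (+ 1 - + (suc k ℕ.+ d)) + t) (sym (ℤ.pos-* 2 k)))) ,
  ≤-by (2 ℕ.* d) (begin
    + (suc k ℕ.+ d) - + 1                                 ≡⟨ cong (_- + 1) N≡ ⟩
    (+ 1 + + k + + d) - + 1                               ≡⟨ ring (+ k) (+ d) ⟩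
    ((+ 1 - (+ 1 + + k + + d)) + + 2 * + k) + + 2 * + d   ≡⟨ cong₂ (λ N t → ((+ 1 - N) + + 2 * + k) + t)
                                                                 (sym N≡) (sym (ℤ.pos-* 2 d)) ⟩
    ((+ 1 - + (suc k ℕ.+ d)) + + 2 * + k) + + (2 ℕ.* d)   ≡⟨ cong (_+ + (2 ℕ.* d)) (sym z≡) ⟩
    z + + (2 ℕ.* d)                                       ∎)
  where
  ≤-by : ∀ {x y} n → y ≡ x + + n → x ≤ℤ y
  ≤-by {x} n y≡ = subst (x ≤ℤ_) (sym y≡) (ℤ.i≤i+j x (+ n))
  N≡ : + (suc k ℕ.+ d) ≡ + 1 + + k + + d
  N≡ = trans (ℤ.pos-+ (suc k) d) (cong (_+ + d) (ℤ.pos-+ 1 k))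
  ring : ∀ K D → (+ 1 + K + D) - + 1 ≡ ((+ 1 - (+ 1 + K + D)) + + 2 * K) + + 2 * D
  ring = solve-∀

InN-suc-bounds : ∀ {x N} → InN N (+ 1 + x) → - + N ≤ℤ x × x ≤ℤ + N - + 2
InN-suc-bounds {x} {N} 1+x∈𝒩 with InN-bounds 1+x∈𝒩
... | lower , upper =
  +-cancelˡ-≤ (+ 1) lower , +-cancelˡ-≤ (+ 1) (subst (+ 1 + x ≤ℤ_) (ring (+ N)) upper)
  where
  ring : ∀ N → N - + 1 ≡ + 1 + (N - + 2)
  ring = solve-∀

InQ : ℕ → ℤ → Set
InQ n z = ∃[ c ] c < n × z ≡ + 3 - + 2 * + n + + 4 * + c

InQ-reflect : ∀ {n z} → InQ n z → InQ n (+ 2 - z)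
InQ-reflect {n} {z} (c , c<n , z≡) with ℕ.m≤n⇒∃[o]m+o≡n c<n
... | c′ , refl = c′ , s≤s (ℕ.m≤n+m c′ c) , (begin
  + 2 - z                                              ≡⟨ cong (λ t → + 2 - t) z≡ ⟩
  + 2 - (+ 3 - + 2 * + n + + 4 * + c)                  ≡⟨ cong (λ t → + 2 - (+ 3 - + 2 * t + + 4 * + c)) n≡ ⟩
  + 2 - (+ 3 - + 2 * (+ 1 + + c + + c′) + + 4 * + c)   ≡⟨ ring (+ c) (+ c′) ⟩
  + 3 - + 2 * (+ 1 + + c + + c′) + + 4 * + c′          ≡⟨ cong (λ t → + 3 - + 2 * t + + 4 * + c′) (sym n≡) ⟩
  + 3 - + 2 * + n + + 4 * + c′                         ∎)
  where
  n≡ : + n ≡ + 1 + + c + + c′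
  n≡ = trans (ℤ.pos-+ (suc c) c′) (cong (_+ + c′) (ℤ.pos-+ 1 c))
  ring : ∀ C C′ → + 2 - (+ 3 - + 2 * (+ 1 + C + C′) + + 4 * C)
                 ≡ + 3 - + 2 * (+ 1 + C + C′) + + 4 * C′
  ring = solve-∀

-- An odd index k = 1 + 2c gives an element of 𝒬ₙ; an even index k = 2c gives z = w - 2 with
-- w ∈ 𝒬ₙ, and then -z = 2 - w ∈ 𝒬ₙ.
InN⇔InQ : ∀ n {z} → InN (n ℕ.* 2) z ⇔ (InQ n z ⊎ InQ n (- z))
InN⇔InQ n {z} = mk⇔ split merge
  where
  odd-index : ∀ c → (+ 1 - + (n ℕ.* 2)) + + 2 * + (1 ℕ.+ c ℕ.* 2) ≡ + 3 - + 2 * + n + + 4 * + c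
  odd-index c = trans (cong₂ (λ N k → (+ 1 - N) + + 2 * k) (ℤ.pos-* n 2) k≡) (ring (+ n) (+ c))
    where
    k≡ : + (1 ℕ.+ c ℕ.* 2) ≡ + 1 + + c * + 2
    k≡ = trans (ℤ.pos-+ 1 (c ℕ.* 2)) (cong (λ t → + 1 + t) (ℤ.pos-* c 2))
    ring : ∀ N C → (+ 1 - N * + 2) + + 2 * (+ 1 + C * + 2) ≡ + 3 - + 2 * N + + 4 * C
    ring = solve-∀
  even-index : ∀ c → (+ 1 - + (n ℕ.* 2)) + + 2 * + (c ℕ.* 2) ≡ (+ 3 - + 2 * + n + + 4 * + c) - + 2
  even-index c =
    trans (cong₂ (λ N k → (+ 1 - N) + + 2 * k) (ℤ.pos-* n 2) (ℤ.pos-* c 2)) (ring (+ n) (+ c))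
    where
    ring : ∀ N C → (+ 1 - N * + 2) + + 2 * (C * + 2) ≡ (+ 3 - + 2 * N + + 4 * C) - + 2
    ring = solve-∀
  negate : ∀ w → - (w - + 2) ≡ + 2 - w
  negate = solve-∀
  split : InN (n ℕ.* 2) z → InQ n z ⊎ InQ n (- z)
  split (k , k<2n , z≡) with <*⇒digits {n = n} 2 k<2n
  ... | 1 , c , _ , c<n , refl = inj₁ (c , c<n , trans z≡ (odd-index c))
  ... | 0 , c , _ , c<n , refl = inj₂ (subst (InQ n) (sym -z≡) (InQ-reflect (c , c<n , refl)))
    where
    -z≡ : - z ≡ + 2 - (+ 3 - + 2 * + n + + 4 * + c)
    -z≡ = trans (cong -_ (trans z≡ (even-index c))) (negate (+ 3 - + 2 * + n + + 4 * + c))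
  ... | suc (suc _) , _ , s≤s (s≤s ()) , _ , _
  merge : InQ n z ⊎ InQ n (- z) → InN (n ℕ.* 2) z
  merge (inj₁ (c , c<n , z≡)) =
    1 ℕ.+ c ℕ.* 2 , digits⇒<* {n = n} (s≤s (s≤s z≤n)) c<n , trans z≡ (sym (odd-index c))
  merge (inj₂ -z∈Q) with InQ-reflect -z∈Q
  ... | c , c<n , 2+z≡ = c ℕ.* 2 , digits⇒<* {n = n} (s≤s z≤n) c<n , (begin
    z                                              ≡⟨ unshift z ⟩
    (+ 2 - - z) - + 2                              ≡⟨ cong (_- + 2) 2+z≡ ⟩
    (+ 3 - + 2 * + n + + 4 * + c) - + 2            ≡⟨ even-index c ⟨
    (+ 1 - + (n ℕ.* 2)) + + 2 * + (c ℕ.* 2)        ∎)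
    where
    unshift : ∀ y → y ≡ (+ 2 - - y) - + 2
    unshift = solve-∀

-- Radix-n expansion c = d + q n of the index.
InQ-product : ∀ m n .{{_ : NonZero n}} {z} →
              InQ (m ℕ.* n) z ⇔ (∃[ x ] ∃[ y ] InQ n x × InQ m y × z ≡ x + (y * + n - + n))
InQ-product m n {z} = mk⇔ split merge
  where
  expand : ∀ d q → (+ 3 - + 2 * + n + + 4 * + d) + ((+ 3 - + 2 * + m + + 4 * + q) * + n - + n)
                   ≡ + 3 - + 2 * + (m ℕ.* n) + + 4 * + (d ℕ.+ q ℕ.* n)
  expand d q = trans (ring (+ m) (+ n) (+ d) (+ q)) (sym (cong₂ (λ P c → + 3 - + 2 * P + + 4 * c)
                 (ℤ.pos-* m n) (trans (ℤ.pos-+ d (q ℕ.* n)) (cong (λ t → + d + t) (ℤ.pos-* q n)))))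
    where
    ring : ∀ M N D Q → (+ 3 - + 2 * N + + 4 * D) + ((+ 3 - + 2 * M + + 4 * Q) * N - N)
                       ≡ + 3 - + 2 * (M * N) + + 4 * (D + Q * N)
    ring = solve-∀
  split : InQ (m ℕ.* n) z → ∃[ x ] ∃[ y ] InQ n x × InQ m y × z ≡ x + (y * + n - + n)
  split (c , c<mn , z≡) with <*⇒digits {n = m} n c<mn
  ... | d , q , d<n , q<m , refl =
    _ , _ , (d , d<n , refl) , (q , q<m , refl) , trans z≡ (sym (expand d q))
  merge : (∃[ x ] ∃[ y ] InQ n x × InQ m y × z ≡ x + (y * + n - + n)) → InQ (m ℕ.* n) z
  merge (_ , _ , (d , d<n , refl) , (q , q<m , refl) , z≡) =
    d ℕ.+ q ℕ.* n , digits⇒<* d<n q<m , trans z≡ (expand d q)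

InSums⁺ : ℕ → Seq → Seq → ℤ → Set
InSums⁺ m a b z = ∃[ i ] ∃[ j ] (i < m × j < m × z ≡ a i + b j)

InSums⇔InSums⁺± : ∀ {m a b z} → InSums m a b z ⇔ (InSums⁺ m a b z ⊎ InSums⁺ m a b (- z))
InSums⇔InSums⁺± {m} {a} {b} {z} = mk⇔ split merge
  where
  split : InSums m a b z → InSums⁺ m a b z ⊎ InSums⁺ m a b (- z)
  split (i , j , i<m , j<m , inj₁ z≡) = inj₁ (i , j , i<m , j<m , z≡)
  split (i , j , i<m , j<m , inj₂ z≡) = inj₂ (i , j , i<m , j<m , trans (cong -_ z≡) (ℤ.neg-involutive _))
  merge : InSums⁺ m a b z ⊎ InSums⁺ m a b (- z) → InSums m a b z
  merge (inj₁ (i , j , i<m , j<m , z≡)) = i , j , i<m , j<m , inj₁ z≡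
  merge (inj₂ (i , j , i<m , j<m , -z≡)) =
    i , j , i<m , j<m , inj₂ (trans (sym (ℤ.neg-involutive z)) (cong -_ -z≡))

InSums-neg : ∀ {m a b z} → InSums m a b z → InSums m a b (- z)
InSums-neg (i , j , i<m , j<m , inj₁ z≡) = i , j , i<m , j<m , inj₂ (cong -_ z≡)
InSums-neg (i , j , i<m , j<m , inj₂ z≡) = i , j , i<m , j<m , inj₁ (trans (cong -_ z≡) (ℤ.neg-involutive _))

InSums-⊆ : ∀ {m a′ b′ a b z} → (∀ {i j} → i < m → j < m → InSums m a′ b′ (a i + b j)) →
           InSums m a b z → InSums m a′ b′ z
InSums-⊆ sums⊆ (_ , _ , i<m , j<m , inj₁ refl) = sums⊆ i<m j<m
InSums-⊆ {a′ = a′} {b′} sums⊆ (_ , _ , i<m , j<m , inj₂ refl) =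
  InSums-neg {a = a′} {b = b′} (sums⊆ i<m j<m)

InSums-swap : ∀ {m z} a b → InSums m a b z → InSums m b a z
InSums-swap a b (i , j , i<m , j<m , inj₁ z≡) =
  j , i , j<m , i<m , inj₁ (trans z≡ (ℤ.+-comm (a i) (b j)))
InSums-swap a b (i , j , i<m , j<m , inj₂ z≡) =
  j , i , j<m , i<m , inj₂ (trans z≡ (cong -_ (ℤ.+-comm (a i) (b j))))

MirrorClosed : ℕ → ℤ → Seq → Set
MirrorClosed m c a = ∀ {i} → i < m → ∃[ i′ ] i′ < m × a i + a i′ ≡ c

SameOrMirrored : ℤ → ℤ → ℤ → Set
SameOrMirrored c x y = y ≡ x ⊎ x + y ≡ c

SameOrMirrored-sym : ∀ {c x y} → SameOrMirrored c x y → SameOrMirrored c y x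
SameOrMirrored-sym {x = x} {y} = ⊎.map sym (trans (ℤ.+-comm y x))

cancel-crosswise : ∀ {c x x′ y y′} → x + x′ ≡ c → y + y′ ≡ - c → x + y ≡ - (x′ + y′)
cancel-crosswise {c} {x} {x′} {y} {y′} x+x′≡c y+y′≡-c = begin
  x + y                              ≡⟨ regroup x x′ y y′ ⟩
  (x + x′) + (y + y′) - (x′ + y′)    ≡⟨ cong₂ (λ s t → s + t - (x′ + y′)) x+x′≡c y+y′≡-c ⟩
  c + - c - (x′ + y′)                ≡⟨ collapse c (x′ + y′) ⟩
  - (x′ + y′)                        ∎
  where
  regroup : ∀ x x′ y y′ → x + y ≡ (x + x′) + (y + y′) - (x′ + y′)
  regroup = solve-∀
  collapse : ∀ c w → c + - c - w ≡ - w
  collapse = solve-∀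

InSums-mirror : ∀ {m c z} a b b′ → MirrorClosed m c a → (∀ j → SameOrMirrored (- c) (b j) (b′ j)) →
                InSums m a b z → InSums m a b′ z
InSums-mirror {m} {c} a b b′ closed b~b′ = InSums-⊆ {a′ = a} {b′ = b′} {a = a} {b = b} sums⊆
  where
  sums⊆ : ∀ {i j} → i < m → j < m → InSums m a b′ (a i + b j)
  sums⊆ {i} {j} i<m j<m with b~b′ j
  ... | inj₁ b′≡b = i , j , i<m , j<m , inj₁ (cong (λ y → a i + y) (sym b′≡b))
  ... | inj₂ b+b′≡-c with closed i<m
  ...   | i′ , i′<m , a+a′≡c =
    i′ , j , i′<m , j<m , inj₂ (cancel-crosswise {x = a i} {a i′} {b j} {b′ j} a+a′≡c b+b′≡-c)

InSums-mirrorʳ : ∀ {m c z} a b b′ → MirrorClosed m c a → (∀ j → SameOrMirrored (- c) (b j) (b′ j)) →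
                 InSums m a b z ⇔ InSums m a b′ z
InSums-mirrorʳ a b b′ closed b~b′ =
  mk⇔ (InSums-mirror a b b′ closed b~b′) (InSums-mirror a b′ b closed (SameOrMirrored-sym ∘ b~b′))

InSums-mirrorˡ : ∀ {m c z} a a′ b → MirrorClosed m c b → (∀ i → SameOrMirrored (- c) (a i) (a′ i)) →
                 InSums m a b z ⇔ InSums m a′ b z
InSums-mirrorˡ a a′ b closed a~a′ =
  mk⇔ (InSums-swap b a′ ∘ InSums-mirror b a a′ closed a~a′ ∘ InSums-swap a b)
      (InSums-swap b a ∘ InSums-mirror b a′ a closed (SameOrMirrored-sym ∘ a~a′) ∘ InSums-swap a′ b)

-- Every a i = a i + b 0 and every 1 + b j = a 0 + b j lies in 𝒩, which forces parities and ranges.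
sums⇒admissible : ∀ {m a b} → 0 < m → a 0 ≡ + 1 → b 0 ≡ + 0 →
                  (∀ z → InSums m a b z ⇔ InN (2 ℕ.* m ℕ.* m) z) → Admissible m a b
sums⇒admissible {m} {a} {b} 0<m a0≡1 b0≡0 sums⇔𝒩 = a-entry , b-entry , a0≡1 , b0≡0 , sums⇔𝒩
  where
  N : ℕ
  N = 2 ℕ.* m ℕ.* m
  sum∈𝒩 : ∀ {i j} → i < m → j < m → InN N (a i + b j)
  sum∈𝒩 {i} {j} i<m j<m = Equivalence.to (sums⇔𝒩 (a i + b j)) (i , j , i<m , j<m , inj₁ refl)
  odd : ∀ {x} → InN N x → OddZ x
  odd {x} x∈𝒩 = InN-odd (m ℕ.* m) (subst (λ n → InN n x) (2mm≡mm2 m) x∈𝒩)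
  a-entry : ∀ i → i < m → OddZ (a i) × (+ 1 - + N) ≤ℤ a i × a i ≤ℤ + N - + 1
  a-entry i i<m = odd aᵢ∈𝒩 , InN-bounds aᵢ∈𝒩
    where
    aᵢ∈𝒩 : InN N (a i)
    aᵢ∈𝒩 = subst (InN N) (trans (cong (λ y → a i + y) b0≡0) (ℤ.+-identityʳ (a i))) (sum∈𝒩 i<m 0<m)
  b-entry : ∀ j → j < m → EvenZ (b j) × - + N ≤ℤ b j × b j ≤ℤ + N - + 2
  b-entry j j<m = OddZ-suc⇒EvenZ (odd 1+bⱼ∈𝒩) , InN-suc-bounds 1+bⱼ∈𝒩
    where
    1+bⱼ∈𝒩 : InN N (+ 1 + b j)
    1+bⱼ∈𝒩 = subst (λ x → InN N (x + b j)) a0≡1 (sum∈𝒩 0<m j<m)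

seqA-even : ∀ h p → seqA (p ℕ.* 2) ≡ + 3 - + 2 * + suc (h ℕ.* 2) + + 4 * + (h ℕ.+ p)
seqA-even h p = begin
  seqA (p ℕ.* 2)                                      ≡⟨ cong₂ _*_ (-1^[n*2]≡1 p)
                                                           (cong (λ t → + 1 + + 2 * t) (ℤ.pos-* p 2)) ⟩
  + 1 * (+ 1 + + 2 * (+ p * + 2))                     ≡⟨ ring (+ h) (+ p) ⟩
  + 3 - + 2 * (+ 1 + + h * + 2) + + 4 * (+ h + + p)   ≡⟨ cong₂ (λ M c → + 3 - + 2 * M + + 4 * c)
                                                           (sym (+[1+n*2] h)) (sym (ℤ.pos-+ h p)) ⟩
  + 3 - + 2 * + suc (h ℕ.* 2) + + 4 * + (h ℕ.+ p)     ∎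
  where
  ring : ∀ H P → + 1 * (+ 1 + + 2 * (P * + 2)) ≡ + 3 - + 2 * (+ 1 + H * + 2) + + 4 * (H + P)
  ring = solve-∀

seqA-odd : ∀ {h} p e → suc (p ℕ.+ e) ≡ h →
           seqA (suc (p ℕ.* 2)) ≡ + 3 - + 2 * + suc (h ℕ.* 2) + + 4 * + e
seqA-odd p e refl = begin
  seqA (suc (p ℕ.* 2))                                      ≡⟨ cong₂ _*_ (cong (λ t → - + 1 * t) (-1^[n*2]≡1 p))
                                                                 (cong (λ t → + 1 + + 2 * t) (+[1+n*2] p)) ⟩
  - + 1 * + 1 * (+ 1 + + 2 * (+ 1 + + p * + 2))             ≡⟨ ring (+ p) (+ e) ⟩
  + 3 - + 2 * (+ 1 + (+ 1 + + p + + e) * + 2) + + 4 * + e   ≡⟨ cong (λ M → + 3 - + 2 * M + + 4 * + e) (sym M≡) ⟩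
  + 3 - + 2 * + suc (suc (p ℕ.+ e) ℕ.* 2) + + 4 * + e       ∎
  where
  M≡ : + suc (suc (p ℕ.+ e) ℕ.* 2) ≡ + 1 + (+ 1 + + p + + e) * + 2
  M≡ = trans (+[1+n*2] (suc (p ℕ.+ e)))
             (cong (λ t → + 1 + t * + 2) (trans (ℤ.pos-+ (suc p) e) (cong (_+ + e) (ℤ.pos-+ 1 p))))
  ring : ∀ P E → - + 1 * + 1 * (+ 1 + + 2 * (+ 1 + P * + 2))
                 ≡ + 3 - + 2 * (+ 1 + (+ 1 + P + E) * + 2) + + 4 * E
  ring = solve-∀

replB-mirrors : ∀ s b j → SameOrMirrored (- + 2) (b j) (replB s b j)
replB-mirrors s b j with s j
... | false = inj₁ refl
... | true = inj₂ (ring (b j))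
  where
  ring : ∀ x → x + (- x - + 2) ≡ - + 2
  ring = solve-∀

replA-negates : ∀ s a i → SameOrMirrored 0ℤ (a i) (replA s a i)
replA-negates s a i with s i
... | false = inj₁ refl
... | true = inj₂ (ℤ.+-inverseʳ (a i))

replB-keeps : ∀ s b {i} → s i ≡ false → replB s b i ≡ b i
replB-keeps s b sᵢ≡false rewrite sᵢ≡false = refl

replA-keeps : ∀ s a {i} → s i ≡ false → replA s a i ≡ a i
replA-keeps s a sᵢ≡false rewrite sᵢ≡false = refl

module Construction (h : ℕ) where
  m : ℕ
  m = suc (h ℕ.* 2)

  seqA∈Q : ∀ {i} → i < m → InQ m (seqA i)
  seqA∈Q {i} i<m with <*⇒digits {n = suc h} 2 (ℕ.m<n⇒m<1+n i<m)
  ... | 0 , p , _ , p<1+h , refl = h ℕ.+ p , s≤s h+p≤h*2 , seqA-even h p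
    where
    h+p≤h*2 : h ℕ.+ p ≤ h ℕ.* 2
    h+p≤h*2 = subst (h ℕ.+ p ≤_) (sym (n*2≡n+n h)) (ℕ.+-monoʳ-≤ h (ℕ.≤-pred p<1+h))
  ... | 1 , p , _ , _ , refl with ℕ.m≤n⇒∃[o]m+o≡n (ℕ.*-cancelʳ-< 2 p h (ℕ.≤-pred i<m))
  ...   | e , 1+p+e≡h = e , s≤s e≤h*2 , seqA-odd p e 1+p+e≡h
    where
    e≤h*2 : e ≤ h ℕ.* 2
    e≤h*2 = ℕ.≤-trans (subst (e ≤_) 1+p+e≡h (ℕ.m≤n+m e (suc p))) (ℕ.m≤m*n h 2)
  seqA∈Q i<m | suc (suc _) , _ , s≤s (s≤s ()) , _ , _

  InQ→seqA : ∀ {z} → InQ m z → ∃[ i ] i < m × z ≡ seqA i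
  InQ→seqA (c , c<m , refl) with ℕ.≤-<-connex h c
  ... | inj₁ h≤c with ℕ.m≤n⇒∃[o]m+o≡n h≤c
  ...   | p , refl = p ℕ.* 2 , s≤s (ℕ.*-monoˡ-≤ 2 p≤h) , sym (seqA-even h p)
    where
    p≤h : p ≤ h
    p≤h = ℕ.+-cancelˡ-≤ h p h (subst (h ℕ.+ p ≤_) (n*2≡n+n h) (ℕ.≤-pred c<m))
  InQ→seqA (c , c<m , refl) | inj₂ c<h with ℕ.m≤n⇒∃[o]m+o≡n c<h
  ...   | p , 1+c+p≡h = suc (p ℕ.* 2) , s≤s (ℕ.*-monoˡ-< 2 p<h) , sym (seqA-odd p c 1+p+c≡h)
    where
    1+p+c≡h : suc (p ℕ.+ c) ≡ h
    1+p+c≡h = trans (cong suc (ℕ.+-comm p c)) 1+c+p≡h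
    p<h : p < h
    p<h = subst (p <_) 1+c+p≡h (s≤s (ℕ.m≤n+m p c))

  seqA-reflect : ∀ {i} → i < m → ∃[ i′ ] i′ < m × + 2 - seqA i ≡ seqA i′
  seqA-reflect i<m = InQ→seqA (InQ-reflect (seqA∈Q i<m))

  seqA-mirror : MirrorClosed m (+ 2) seqA
  seqA-mirror {i} i<m with seqA-reflect i<m
  ... | i′ , i′<m , a′≡ = i′ , i′<m , trans (cong (λ y → seqA i + y) (sym a′≡)) (ring (seqA i))
    where
    ring : ∀ x → x + (+ 2 - x) ≡ + 2
    ring = solve-∀

  seqB-mirror : MirrorClosed m 0ℤ (seqB m)
  seqB-mirror {j} j<m with seqA-reflect j<m
  ... | j′ , j′<m , a′≡ =
    j′ , j′<m , trans (cong (λ y → seqB m j + (y * + m - + m)) (sym a′≡)) (ring (seqA j) (+ m))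
    where
    ring : ∀ x M → (x * M - M) + ((+ 2 - x) * M - M) ≡ 0ℤ
    ring = solve-∀

  InSums⁺⇔InQ : ∀ {z} → InSums⁺ m seqA (seqB m) z ⇔ InQ (m ℕ.* m) z
  InSums⁺⇔InQ {z} = mk⇔ to from
    where
    to : InSums⁺ m seqA (seqB m) z → InQ (m ℕ.* m) z
    to (i , j , i<m , j<m , refl) =
      Equivalence.from (InQ-product m m) (seqA i , seqA j , seqA∈Q i<m , seqA∈Q j<m , refl)
    from : InQ (m ℕ.* m) z → InSums⁺ m seqA (seqB m) z
    from z∈Q with Equivalence.to (InQ-product m m) z∈Q
    ... | x , y , x∈Q , y∈Q , z≡ with InQ→seqA x∈Q | InQ→seqA y∈Q
    ...   | i , i<m , refl | j , j<m , refl = i , j , i<m , j<m , z≡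

  InSums-seqA-seqB : ∀ {z} → InSums m seqA (seqB m) z ⇔ InN (2 ℕ.* m ℕ.* m) z
  InSums-seqA-seqB {z} = ⇔.trans (InSums⇔InSums⁺± {a = seqA} {b = seqB m})
    (⇔.trans (InSums⁺⇔InQ ⊎-⇔ InSums⁺⇔InQ)
             (subst (λ N → (InQ (m ℕ.* m) z ⊎ InQ (m ℕ.* m) (- z)) ⇔ InN N z) (sym (2mm≡mm2 m))
                    (⇔.sym (InN⇔InQ (m ℕ.* m)))))

  seqB0≡0 : seqB m 0 ≡ + 0
  seqB0≡0 = ring (+ m)
    where
    ring : ∀ M → + 1 * M - M ≡ + 0
    ring = solve-∀

  admissible : Admissible m seqA (seqB m)
  admissible = sums⇒admissible (s≤s z≤n) refl seqB0≡0 (λ _ → InSums-seqA-seqB)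

  admissible-replB : (s : ℕ → Bool) → s 0 ≡ false → Admissible m seqA (replB s (seqB m))
  admissible-replB s s0≡false =
    sums⇒admissible (s≤s z≤n) refl (trans (replB-keeps s (seqB m) s0≡false) seqB0≡0)
      (λ _ → ⇔.trans (⇔.sym (InSums-mirrorʳ seqA (seqB m) b′ seqA-mirror (replB-mirrors s (seqB m))))
                     InSums-seqA-seqB)
    where
    b′ : Seq
    b′ = replB s (seqB m)

  admissible-replA : (s : ℕ → Bool) → s 0 ≡ false → Admissible m (replA s seqA) (seqB m)
  admissible-replA s s0≡false =
    sums⇒admissible (s≤s z≤n) (replA-keeps s seqA s0≡false) seqB0≡0
      (λ _ → ⇔.trans (⇔.sym (InSums-mirrorˡ seqA a′ (seqB m) seqB-mirror (replA-negates s seqA)))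
                     InSums-seqA-seqB)
    where
    a′ : Seq
    a′ = replA s seqA

m≡1+[m/2]*2 : ∀ m → m % 2 ≡ 1 → m ≡ suc (m / 2 ℕ.* 2)
m≡1+[m/2]*2 m m%2≡1 = trans (m≡m%n+[m/n]*n m 2) (cong (ℕ._+ m / 2 ℕ.* 2) m%2≡1)

lemma3p8 : (m : ℕ) → 3 ≤ m → m % 2 ≡ 1 →
    Admissible m seqA (seqB m)
    × ((s : ℕ → Bool) → s 0 ≡ false → Admissible m seqA (replB s (seqB m)))
    × ((s : ℕ → Bool) → s 0 ≡ false → Admissible m (replA s seqA) (seqB m))
lemma3p8 m _ m%2≡1 with m / 2 | m≡1+[m/2]*2 m m%2≡1
... | h | refl = admissible , admissible-replB , admissible-replA
  where
  open Construction h
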